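{- If there is a superpolynomial gap between dag-size and tree-size, then propositional logic does not have polynomial tree-size Craig interpolants.
   Context: Propositional formulas are built from atoms using $\top,\bot,\neg,\wedge,\vee$ (with $\rightarrow,\leftrightarrow$ as abbreviations). The dag-size $|\varphi|$ is the number of distinct subformulas of $\varphi$. The tree-size $s(\varphi)$ is defined by $s(p)=s(\top)=s(\bot)=1$, $s(\neg\varphi)=s(\varphi)+1$, $s(\varphi\wedge\psi)=s(\varphi\vee\psi)=s(\varphi)+s(\psi)+1$. There is a superpolynomial gap between dag-size and tree-size if there is no pair consisting of a function $e$ mapping every propositional formula $\varphi$ to a logically equivalent formula $e(\varphi)$ and a polynomial $f$ with $s(e(\varphi))\le f(|\varphi|)$ for all $\varphi$. A Craig interpolant for $\varphi,\psi$ is a formula $\chi$ with $\varphi\models\chi$, $\chi\models\psi$ and $\mathrm{sig}(\chi)\subseteq\mathrm{sig}(\varphi)\cap\mathrm{sig}(\psi)$ ($\mathrm{sig}$ = set of atoms). Propositional logic has polynomial tree-size Craig interpolants if there is a polynomial $f:\mathbb{N}\times\mathbb{N}\to\mathbb{N}$ such that for all $\varphi,\psi$ with $\varphi\models\psi$ there is a Craig interpolant $\chi$ for $\varphi,\psi$ with $s(\chi)\le f(|\varphi|,|\psi|)$. -}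

module Defs where

open import Data.Nat using (ℕ; zero; suc; _+_; _*_; _≤_)
open import Data.Bool using (Bool; true; false; not; _∧_; _∨_)
open import Data.List using (List; []; _∷_; _++_; length; deduplicate)
open import Data.List.Membership.Propositional using (_∈_)
open import Data.Product using (Σ; _×_; _,_)
open import Relation.Nullary using (¬_; Dec; yes; no)
open import Relation.Binary.PropositionalEquality using (_≡_; refl; cong; cong₂)
import Data.Nat.Properties as ℕP

Atom : Set
Atom = ℕ

-- Propositional formulas over ⊤, ⊥, ¬, ∧, ∨ (→, ↔ are abbreviations).
data Formula : Set where
  atom : Atom → Formula
  ⊤f   : Formula
  ⊥f   : Formula
  ¬f_  : Formula → Formula
  _∧f_ : Formula → Formula → Formula
  _∨f_ : Formula → Formula → Formula

_≟f_ : (φ ψ : Formula) → Dec (φ ≡ ψ)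
atom p ≟f atom q with p ℕP.≟ q
... | yes refl = yes refl
... | no ne = no λ { refl → ne refl }
atom _ ≟f ⊤f = no λ ()
atom _ ≟f ⊥f = no λ ()
atom _ ≟f (¬f _) = no λ ()
atom _ ≟f (_ ∧f _) = no λ ()
atom _ ≟f (_ ∨f _) = no λ ()
⊤f ≟f atom _ = no λ ()
⊤f ≟f ⊤f = yes refl
⊤f ≟f ⊥f = no λ ()
⊤f ≟f (¬f _) = no λ ()
⊤f ≟f (_ ∧f _) = no λ ()
⊤f ≟f (_ ∨f _) = no λ ()
⊥f ≟f atom _ = no λ ()
⊥f ≟f ⊤f = no λ ()
⊥f ≟f ⊥f = yes refl
⊥f ≟f (¬f _) = no λ ()
⊥f ≟f (_ ∧f _) = no λ ()
⊥f ≟f (_ ∨f _) = no λ ()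
(¬f _) ≟f atom _ = no λ ()
(¬f _) ≟f ⊤f = no λ ()
(¬f _) ≟f ⊥f = no λ ()
(¬f φ) ≟f (¬f ψ) with φ ≟f ψ
... | yes refl = yes refl
... | no ne = no λ { refl → ne refl }
(¬f _) ≟f (_ ∧f _) = no λ ()
(¬f _) ≟f (_ ∨f _) = no λ ()
(_ ∧f _) ≟f atom _ = no λ ()
(_ ∧f _) ≟f ⊤f = no λ ()
(_ ∧f _) ≟f ⊥f = no λ ()
(_ ∧f _) ≟f (¬f _) = no λ ()
(φ₁ ∧f φ₂) ≟f (ψ₁ ∧f ψ₂) with φ₁ ≟f ψ₁ | φ₂ ≟f ψ₂
... | yes refl | yes refl = yes refl
... | no ne | _ = no λ { refl → ne refl }
... | yes _ | no ne = no λ { refl → ne refl }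
(_ ∧f _) ≟f (_ ∨f _) = no λ ()
(_ ∨f _) ≟f atom _ = no λ ()
(_ ∨f _) ≟f ⊤f = no λ ()
(_ ∨f _) ≟f ⊥f = no λ ()
(_ ∨f _) ≟f (¬f _) = no λ ()
(_ ∨f _) ≟f (_ ∧f _) = no λ ()
(φ₁ ∨f φ₂) ≟f (ψ₁ ∨f ψ₂) with φ₁ ≟f ψ₁ | φ₂ ≟f ψ₂
... | yes refl | yes refl = yes refl
... | no ne | _ = no λ { refl → ne refl }
... | yes _ | no ne = no λ { refl → ne refl }

Valuation : Set
Valuation = Atom → Bool

eval : Valuation → Formula → Bool
eval v (atom p) = v p
eval v ⊤f = true
eval v ⊥f = false
eval v (¬f φ) = not (eval v φ)
eval v (φ ∧f ψ) = eval v φ ∧ eval v ψ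
eval v (φ ∨f ψ) = eval v φ ∨ eval v ψ

_⊨_ : Formula → Formula → Set
φ ⊨ ψ = (v : Valuation) → eval v φ ≡ true → eval v ψ ≡ true

_≡ₗ_ : Formula → Formula → Set
φ ≡ₗ ψ = (v : Valuation) → eval v φ ≡ eval v ψ

-- Signature: list of atoms occurring in a formula (membership is what matters).
sig : Formula → List Atom
sig (atom p) = p ∷ []
sig ⊤f = []
sig ⊥f = []
sig (¬f φ) = sig φ
sig (φ ∧f ψ) = sig φ ++ sig ψ
sig (φ ∨f ψ) = sig φ ++ sig ψ

subformulas : Formula → List Formula
subformulas (atom p) = atom p ∷ []
subformulas ⊤f = ⊤f ∷ []
subformulas ⊥f = ⊥f ∷ []
subformulas (¬f φ) = (¬f φ) ∷ subformulas φ
subformulas (φ ∧f ψ) = (φ ∧f ψ) ∷ (subformulas φ ++ subformulas ψ)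
subformulas (φ ∨f ψ) = (φ ∨f ψ) ∷ (subformulas φ ++ subformulas ψ)

dagSize : Formula → ℕ
dagSize φ = length (deduplicate _≟f_ (subformulas φ))

treeSize : Formula → ℕ
treeSize (atom _) = 1
treeSize ⊤f = 1
treeSize ⊥f = 1
treeSize (¬f φ) = treeSize φ + 1
treeSize (φ ∧f ψ) = treeSize φ + treeSize ψ + 1
treeSize (φ ∨f ψ) = treeSize φ + treeSize ψ + 1

-- Univariate polynomials with natural coefficients (list of coefficients,
-- constant term first), evaluated by Horner's rule.
Poly : Set
Poly = List ℕ

evalPoly : Poly → ℕ → ℕ
evalPoly [] n = 0
evalPoly (c ∷ cs) n = c + n * evalPoly cs n

-- Bivariate polynomials: coefficients are univariate polynomials in the
-- second variable, powers of the first variable.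
Poly2 : Set
Poly2 = List Poly

evalPoly2 : Poly2 → ℕ → ℕ → ℕ
evalPoly2 [] m n = 0
evalPoly2 (p ∷ ps) m n = evalPoly p n + m * evalPoly2 ps m n

SuperpolynomialGap : Set
SuperpolynomialGap =
  ¬ (Σ (Formula → Formula) λ e → Σ Poly λ f →
       ((φ : Formula) → e φ ≡ₗ φ) ×
       ((φ : Formula) → treeSize (e φ) ≤ evalPoly f (dagSize φ)))

IsInterpolant : Formula → Formula → Formula → Set
IsInterpolant φ ψ χ =
  (φ ⊨ χ) × (χ ⊨ ψ) × ((p : Atom) → p ∈ sig χ → (p ∈ sig φ) × (p ∈ sig ψ))

PolyTreeSizeInterpolants : Set
PolyTreeSizeInterpolants =
  Σ Poly2 λ f → (φ ψ : Formula) → φ ⊨ ψ →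
    Σ Formula λ χ → IsInterpolant φ ψ χ × (treeSize χ ≤ evalPoly2 f (dagSize φ) (dagSize ψ))

{-# OPTIONS --safe #-}
module Submission where

-- A Craig interpolant for the trivial entailment φ ⊨ φ is logically equivalent
-- to φ. So polynomial tree-size interpolants yield, for every φ, an equivalent
-- formula of tree-size at most f(|φ|, |φ|), a polynomial in the dag-size |φ|;
-- that is exactly what a superpolynomial gap rules out.

open import Defs
open import Relation.Nullary using (¬_)
open import Data.Nat using (_+_; _*_; _≤_)
open import Data.Nat.Properties using (+-identityʳ; ≤-trans; ≤-reflexive)
open import Data.Nat.Solver using (module +-*-Solver)
open import Data.Bool.Properties using (⇔→≡)
open import Data.List using ([]; _∷_)
open import Data.Product using (_,_; proj₁; proj₂)
open import Function.Bundles using (mk⇔)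
open import Relation.Binary.PropositionalEquality using (_≡_; refl; sym; trans; cong)

infixl 6 _+ₚ_

_+ₚ_ : Poly → Poly → Poly
[]      +ₚ q       = q
(a ∷ p) +ₚ []      = a ∷ p
(a ∷ p) +ₚ (b ∷ q) = (a + b) ∷ (p +ₚ q)

evalPoly-+ₚ : ∀ p q n → evalPoly (p +ₚ q) n ≡ evalPoly p n + evalPoly q n
evalPoly-+ₚ []      q       n = refl
evalPoly-+ₚ (a ∷ p) []      n = sym (+-identityʳ _)
evalPoly-+ₚ (a ∷ p) (b ∷ q) n =
  trans (cong (λ s → a + b + n * s) (evalPoly-+ₚ p q n))
        (interchange a b n (evalPoly p n) (evalPoly q n))
  where
  open +-*-Solver
  interchange : ∀ a b n x y → a + b + n * (x + y) ≡ (a + n * x) + (b + n * y)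
  interchange = solve 5 (λ a b n x y →
    a :+ b :+ n :* (x :+ y) := (a :+ n :* x) :+ (b :+ n :* y)) refl

diagonal : Poly2 → Poly
diagonal []       = []
diagonal (p ∷ ps) = p +ₚ (0 ∷ diagonal ps)

evalPoly-diagonal : ∀ ps n → evalPoly (diagonal ps) n ≡ evalPoly2 ps n n
evalPoly-diagonal []       n = refl
evalPoly-diagonal (p ∷ ps) n =
  trans (evalPoly-+ₚ p (0 ∷ diagonal ps) n)
        (cong (λ s → evalPoly p n + n * s) (evalPoly-diagonal ps n))

⊨-refl : (φ : Formula) → φ ⊨ φ
⊨-refl φ v holds = holds

⊨-antisym : (φ ψ : Formula) → φ ⊨ ψ → ψ ⊨ φ → φ ≡ₗ ψ
⊨-antisym φ ψ φ⊨ψ ψ⊨φ v = ⇔→≡ (mk⇔ (φ⊨ψ v) (ψ⊨φ v))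

interpolant-self-≡ₗ : (φ χ : Formula) → IsInterpolant φ φ χ → χ ≡ₗ φ
interpolant-self-≡ₗ φ χ (φ⊨χ , χ⊨φ , _) = ⊨-antisym χ φ χ⊨φ φ⊨χ

mainTheorem15 : SuperpolynomialGap → ¬ PolyTreeSizeInterpolants
mainTheorem15 gap (f , interpolate) = gap (e , diagonal f , e-≡ₗ , e-treeSize)
  where
  e : Formula → Formula
  e φ = proj₁ (interpolate φ φ (⊨-refl φ))

  e-interpolates : (φ : Formula) → IsInterpolant φ φ (e φ)
  e-interpolates φ = proj₁ (proj₂ (interpolate φ φ (⊨-refl φ)))

  e-≡ₗ : (φ : Formula) → e φ ≡ₗ φ
  e-≡ₗ φ = interpolant-self-≡ₗ φ (e φ) (e-interpolates φ)

  e-treeSize : (φ : Formula) → treeSize (e φ) ≤ evalPoly (diagonal f) (dagSize φ)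
  e-treeSize φ = ≤-trans (proj₂ (proj₂ (interpolate φ φ (⊨-refl φ))))
                         (≤-reflexive (sym (evalPoly-diagonal f (dagSize φ))))
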